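{- Let $W_+ = \{(x,y) \in \mathbb{Z}^2 : y > x^2\}$ and $W_- = \{(x,y) \in \mathbb{Z}^2 : y < x^2\}$. Neither $W_+$ nor $W_-$ admits a minimal complement in $\mathbb{Z}^2$.
   Context: For an abelian group $G$ and nonempty subsets $W, W' \subseteq G$, $W'$ is a complement of $W$ in $G$ if $W + W' = G$; it is a minimal complement if moreover $W + (W' \setminus \{w'\}) \neq G$ for every $w' \in W'$. -}

module Defs where

open import Level using (0ℓ)
open import Data.Integer using (ℤ; _+_; _*_; _<_; _>_)
open import Data.Product using (_×_; _,_; Σ; ∃; ∃-syntax)
open import Relation.Binary.PropositionalEquality using (_≡_)
open import Relation.Nullary using (¬_)

ℤ² : Set
ℤ² = ℤ × ℤ

_+²_ : ℤ² → ℤ² → ℤ²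
(a , b) +² (c , d) = (a + c , b + d)

Subset : Set₁
Subset = ℤ² → Set

Nonempty : Subset → Set
Nonempty S = ∃[ s ] S s

SumIsAll : Subset → Subset → Set
SumIsAll A B = ∀ (g : ℤ²) → ∃[ a ] ∃[ b ] (A a × B b × g ≡ a +² b)

IsComplement : Subset → Subset → Set
IsComplement W W' = Nonempty W' × SumIsAll W W'

Remove : Subset → ℤ² → Subset
Remove S w' s = S s × ¬ (s ≡ w')

IsMinimalComplement : Subset → Subset → Set
IsMinimalComplement W W' =
  IsComplement W W' × (∀ (w' : ℤ²) → W' w' → ¬ SumIsAll W (Remove W' w'))

HasMinimalComplement : Subset → Set₁
HasMinimalComplement W = Σ Subset (λ W' → IsMinimalComplement W W')

W₊ : Subset
W₊ (x , y) = y > x * x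

W₋ : Subset
W₋ (x , y) = y < x * x

module Submission where

-- Call δ : ℤ² → ℤ² an escaping shift for W ⊆ ℤ² if, for every
-- a ∈ W, the translate W + δ(a) lies inside W while a - δ(a) lies outside W.
-- Such a W has no minimal complement: let W' be a complement, w' ∈ W', and
-- g ∈ ℤ².  Write g = a + b with a ∈ W, b ∈ W'.  If b ≠ w' we are done.  If
-- b = w', write g - δ(a) = a' + b'.  Then b' ≠ w', since otherwise
-- a' = a - δ(a) ∉ W; hence g = (a' + δ(a)) + b' with a' + δ(a) ∈ W and
-- b' ∈ W' ∖ {w'}.  So W' ∖ {w'} is still a complement, and W' is not minimal.
--
-- For W₊ and W₋ the vertical shift δ(x, y) = (0, y - x²) escapes: it moves
-- a point onto the parabola y = x², which belongs to neither set, and it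
-- points up (for W₊) resp. down (for W₋), the direction in which the set is
-- closed.

open import Defs
open import Data.Empty using (⊥-elim)
open import Data.Integer using (_+_; _-_; -_; _*_; _<_; _≤_; +_)
open import Data.Integer.Properties
  using (_≟_; <-irrefl; <⇒≤; +-mono-<-≤; +-monoˡ-≤)
open import Data.Integer.Tactic.RingSolver using (solve-∀)
open import Data.Product using (_×_; _,_; proj₁; proj₂)
open import Data.Product.Properties using (≡-dec)
open import Relation.Binary.Definitions using (DecidableEquality)
open import Relation.Binary.PropositionalEquality
  using (_≡_; refl; sym; cong; cong₂; subst; module ≡-Reasoning)
open import Relation.Nullary using (¬_; yes; no)

_≟²_ : DecidableEquality ℤ²
_≟²_ = ≡-dec _≟_ _≟_

_-²_ : ℤ² → ℤ² → ℤ²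
(a , b) -² (c , d) = (a - c , b - d)

move-shift : ∀ g d a b → g - d ≡ a + b → g ≡ (a + d) + b
move-shift g d a b g-d≡a+b = begin
  g             ≡⟨ lemma g d ⟩
  (g - d) + d   ≡⟨ cong (_+ d) g-d≡a+b ⟩
  (a + b) + d   ≡⟨ swap a b d ⟩
  (a + d) + b   ∎
  where
  open ≡-Reasoning
  lemma : ∀ g d → g ≡ (g - d) + d
  lemma = solve-∀
  swap : ∀ a b d → (a + b) + d ≡ (a + d) + b
  swap = solve-∀

cancel-right : ∀ a b d a' → (a + b) - d ≡ a' + b → a' ≡ a - d
cancel-right a b d a' eq = begin
  a'                 ≡⟨ lemma a' b ⟩
  (a' + b) - b       ≡⟨ cong (_- b) eq ⟨
  ((a + b) - d) - b  ≡⟨ regroup a b d ⟩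
  a - d              ∎
  where
  open ≡-Reasoning
  lemma : ∀ a' b → a' ≡ (a' + b) - b
  lemma = solve-∀
  regroup : ∀ a b d → ((a + b) - d) - b ≡ a - d
  regroup = solve-∀

move-shift² : ∀ g d a b → g -² d ≡ a +² b → g ≡ (a +² d) +² b
move-shift² (g₁ , g₂) (d₁ , d₂) (a₁ , a₂) (b₁ , b₂) eq =
  cong₂ _,_ (move-shift g₁ d₁ a₁ b₁ (cong proj₁ eq))
            (move-shift g₂ d₂ a₂ b₂ (cong proj₂ eq))

cancel-right² : ∀ a b d a' → (a +² b) -² d ≡ a' +² b → a' ≡ a -² d
cancel-right² (a₁ , a₂) (b₁ , b₂) (d₁ , d₂) (a'₁ , a'₂) eq =
  cong₂ _,_ (cancel-right a₁ b₁ d₁ a'₁ (cong proj₁ eq))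
            (cancel-right a₂ b₂ d₂ a'₂ (cong proj₂ eq))

record EscapingShift (W : Subset) (δ : ℤ² → ℤ²) : Set where
  field
    stable : ∀ a → W a → ∀ c → W c → W (c +² δ a)
    escape : ∀ a → W a → ¬ W (a -² δ a)

-- The criterion: a set with an escaping shift has no minimal complement,
-- because removing any single point from a complement leaves a complement.
no-minimal-complement : (W : Subset) (δ : ℤ² → ℤ²) →
                        EscapingShift W δ → ¬ HasMinimalComplement W
no-minimal-complement W δ shift (W' , ((w' , w'∈W') , cover) , minimal) =
  minimal w' w'∈W' cover-without-w'
  where
  open EscapingShift shift
  cover-without-w' : SumIsAll W (Remove W' w')
  cover-without-w' g with cover g
  ... | a , b , a∈W , b∈W' , g≡a+b with b ≟² w'
  ...   | no b≢w' = a , b , a∈W , (b∈W' , b≢w') , g≡a+b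
  ...   | yes refl with cover (g -² δ a)
  ...     | a' , b' , a'∈W , b'∈W' , eq with b' ≟² w'
  ...       | no b'≢w' =
              a' +² δ a , b' , stable a a∈W a' a'∈W , (b'∈W' , b'≢w') ,
              move-shift² g (δ a) a' b' eq
  -- b' = w' = b would give a' = a - δ(a) ∈ W, contradicting escape.
  ...       | yes refl with g≡a+b
  ...         | refl = ⊥-elim (escape a a∈W
                         (subst W (cancel-right² a b (δ a) a' eq) a'∈W))

parabola-gap : ℤ² → ℤ²
parabola-gap (x , y) = (+ 0 , y - x * x)

minus-gap-on-parabola : ∀ x y → (x , y) -² parabola-gap (x , y) ≡ (x , x * x)
minus-gap-on-parabola x y = cong₂ _,_ (minus-zero x) (minus-gap x y)
  where
  minus-zero : ∀ x → x - + 0 ≡ x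
  minus-zero = solve-∀
  minus-gap : ∀ x y → y - (y - x * x) ≡ x * x
  minus-gap = solve-∀

plus-gap : ∀ c₁ c₂ a → (c₁ , c₂) +² parabola-gap a ≡ (c₁ , c₂ + proj₂ (parabola-gap a))
plus-gap c₁ c₂ a = cong (_, _) (plus-zero c₁)
  where
  plus-zero : ∀ x → x + + 0 ≡ x
  plus-zero = solve-∀

-- Shifting by a nonnegative resp. nonpositive difference preserves a strict
-- inequality; this is why W₊ is closed upwards and W₋ downwards.
raise-< : ∀ {x y u v} → x < y → u ≤ v → x < y + (v - u)
raise-< {x} {y} {u} {v} x<y u≤v =
  subst (_< y + (v - u)) (cancel x u) (+-mono-<-≤ x<y (+-monoˡ-≤ (- u) u≤v))
  where
  cancel : ∀ x u → x + (u - u) ≡ x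
  cancel = solve-∀

lower-< : ∀ {x y u v} → y < x → v ≤ u → y + (v - u) < x
lower-< {x} {y} {u} {v} y<x v≤u =
  subst (y + (v - u) <_) (cancel x u) (+-mono-<-≤ y<x (+-monoˡ-≤ (- u) v≤u))
  where
  cancel : ∀ x u → x + (u - u) ≡ x
  cancel = solve-∀

parabola-gap-escapes-W₊ : EscapingShift W₊ parabola-gap
parabola-gap-escapes-W₊ = record
  { stable = λ { a a∈W₊ (c₁ , c₂) c∈W₊ →
      subst W₊ (sym (plus-gap c₁ c₂ a)) (raise-< c∈W₊ (<⇒≤ a∈W₊)) }
  ; escape = λ { (x , y) _ →
      subst (λ p → ¬ W₊ p) (sym (minus-gap-on-parabola x y)) (<-irrefl refl) }
  }

parabola-gap-escapes-W₋ : EscapingShift W₋ parabola-gap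
parabola-gap-escapes-W₋ = record
  { stable = λ { a a∈W₋ (c₁ , c₂) c∈W₋ →
      subst W₋ (sym (plus-gap c₁ c₂ a)) (lower-< c∈W₋ (<⇒≤ a∈W₋)) }
  ; escape = λ { (x , y) _ →
      subst (λ p → ¬ W₋ p) (sym (minus-gap-on-parabola x y)) (<-irrefl refl) }
  }

corollary3p2 : ¬ HasMinimalComplement W₊ × ¬ HasMinimalComplement W₋
corollary3p2 =
  no-minimal-complement W₊ parabola-gap parabola-gap-escapes-W₊ ,
  no-minimal-complement W₋ parabola-gap parabola-gap-escapes-W₋
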